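{- Let $\mathbf{L}$ be a dually ms Stone semi-Heyting algebra and $x\in L$. Then $(x^*)'' \le ((x')^*)'$.
   Context: A semi-Heyting algebra is an algebra $\langle L,\vee,\wedge,\to,0,1\rangle$ such that $\langle L,\vee,\wedge,0,1\rangle$ is a bounded lattice and the identities $x\wedge(x\to y)\approx x\wedge y$, $x\wedge(y\to z)\approx x\wedge[(x\wedge y)\to(x\wedge z)]$, and $x\to x\approx 1$ hold; $x^* := x\to 0$ is the pseudocomplement. A dually quasi-De Morgan semi-Heyting algebra is an algebra $\langle L,\vee,\wedge,\to,{}',0,1\rangle$ whose reduct $\langle L,\vee,\wedge,\to,0,1\rangle$ is a semi-Heyting algebra and which satisfies $0'\approx 1$, $1'\approx 0$, $(x\wedge y)'\approx x'\vee y'$, $(x\vee y)''\approx x''\vee y''$, and $x''\le x$. A dually ms Stone semi-Heyting algebra is a dually quasi-De Morgan semi-Heyting algebra that additionally satisfies $(x\vee y)'\approx x'\wedge y'$ and the Stone identity $x^*\vee x^{**}\approx 1$. -}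

module Defs where

open import Level using (Level; suc; _⊔_)
open import Relation.Binary.Core using (Rel)
open import Algebra.Core using (Op₁; Op₂)
open import Algebra.Definitions using (Congruent₁; Congruent₂)
open import Algebra.Lattice.Structures using (IsLattice)

record DmsStoneSH (c ℓ : Level) : Set (suc (c ⊔ ℓ)) where
  infix  4 _≈_ _≤_
  infixr 5 _∨_
  infixr 6 _∧_
  infixr 4 _⇒_
  field
    Carrier : Set c
    _≈_     : Rel Carrier ℓ
    _∨_     : Op₂ Carrier
    _∧_     : Op₂ Carrier
    _⇒_     : Op₂ Carrier
    _′      : Op₁ Carrier
    ⊥       : Carrier
    ⊤       : Carrier

  _≤_ : Rel Carrier ℓ
  x ≤ y = (x ∧ y) ≈ x

  _* : Op₁ Carrier
  x * = x ⇒ ⊥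

  field
    isLattice  : IsLattice _≈_ _∨_ _∧_
    ⊥-least    : ∀ x → ⊥ ≤ x
    ⊤-greatest : ∀ x → x ≤ ⊤
    ⇒-cong     : Congruent₂ _≈_ _⇒_
    ′-cong     : Congruent₁ _≈_ _′
    -- semi-Heyting axioms
    SH1 : ∀ x y → (x ∧ (x ⇒ y)) ≈ (x ∧ y)
    SH2 : ∀ x y z → (x ∧ (y ⇒ z)) ≈ (x ∧ ((x ∧ y) ⇒ (x ∧ z)))
    SH3 : ∀ x → (x ⇒ x) ≈ ⊤
    -- dually quasi-De Morgan axioms
    ⊥′     : (⊥ ′) ≈ ⊤
    ⊤′     : (⊤ ′) ≈ ⊥
    ∧-′    : ∀ x y → ((x ∧ y) ′) ≈ ((x ′) ∨ (y ′))
    ∨-′′   : ∀ x y → (((x ∨ y) ′) ′) ≈ (((x ′) ′) ∨ ((y ′) ′))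
    ′′-≤   : ∀ x → ((x ′) ′) ≤ x
    -- dually ms
    ∨-′    : ∀ x y → ((x ∨ y) ′) ≈ ((x ′) ∧ (y ′))
    -- Stone identity
    stone  : ∀ x → ((x *) ∨ ((x *) *)) ≈ ⊤

module Submission where

-- Since x ∧ x* ≈ 0 and ′ turns meets into joins with 0′ ≈ 1, we get
-- x′ ∨ x*′ ≈ 1.  Put a = x′*.  Then a ∧ x′ ≈ 0, so by distributivity
--   a ≈ a ∧ (x′ ∨ x*′) ≤ (a ∧ x′) ∨ (a ∧ x*′) ≈ 0 ∨ (a ∧ x*′) ≤ x*′ ,
-- i.e. x′* ≤ x*′; applying the antitone map ′ gives the claim.

open import Defs
open import Algebra.Lattice.Bundles using (Lattice)
import Algebra.Lattice.Properties.Lattice as LatticeProperties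
import Relation.Binary.Lattice as OrderTheoretic
import Relation.Binary.Lattice.Properties.MeetSemilattice as MeetSemilatticeProperties
import Relation.Binary.Reasoning.Setoid as SetoidReasoning

module DmsStoneSHProperties {c ℓ} (L : DmsStoneSH c ℓ) where
  open DmsStoneSH L

  lattice : Lattice c ℓ
  lattice = record { isLattice = isLattice }

  open Lattice lattice
    using (setoid; refl; sym; trans; ∧-comm; ∧-assoc; ∧-congˡ; ∧-congʳ)
  open SetoidReasoning setoid

  -- (1) The lattice order.  The standard library orders a lattice by
  -- x ⊑ y :⇔ x ≈ x ∧ y, which is our _≤_ with the equation reversed.

  private
    orderLattice : OrderTheoretic.Lattice c ℓ ℓ
    orderLattice = LatticeProperties.∨-∧-orderTheoreticLattice lattice

    module ⊑ = OrderTheoretic.Lattice orderLattice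
    open ⊑ using () renaming (_≤_ to _⊑_)

    ≤⇒⊑ : ∀ {x y} → x ≤ y → x ⊑ y
    ≤⇒⊑ = sym

    ⊑⇒≤ : ∀ {x y} → x ⊑ y → x ≤ y
    ⊑⇒≤ = sym

  ≤-reflexive : ∀ {x y} → x ≈ y → x ≤ y
  ≤-reflexive x≈y = ⊑⇒≤ (⊑.reflexive x≈y)

  ≤-trans : ∀ {x y z} → x ≤ y → y ≤ z → x ≤ z
  ≤-trans x≤y y≤z = ⊑⇒≤ (⊑.trans (≤⇒⊑ x≤y) (≤⇒⊑ y≤z))

  x∧y≤y : ∀ x y → (x ∧ y) ≤ y
  x∧y≤y x y = ⊑⇒≤ (⊑.x∧y≤y x y)

  ∧-greatest : ∀ {x y z} → x ≤ y → x ≤ z → x ≤ (y ∧ z)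
  ∧-greatest x≤y x≤z = ⊑⇒≤ (⊑.∧-greatest (≤⇒⊑ x≤y) (≤⇒⊑ x≤z))

  ∨-least : ∀ {x y z} → x ≤ z → y ≤ z → (x ∨ y) ≤ z
  ∨-least x≤z y≤z = ⊑⇒≤ (⊑.∨-least (≤⇒⊑ x≤z) (≤⇒⊑ y≤z))

  x≤x∨y : ∀ x y → x ≤ (x ∨ y)
  x≤x∨y x y = ⊑⇒≤ (⊑.x≤x∨y x y)

  y≤x∨y : ∀ x y → y ≤ (x ∨ y)
  y≤x∨y x y = ⊑⇒≤ (⊑.y≤x∨y x y)

  ∧-monotonicʳ : ∀ a {z w} → z ≤ w → (a ∧ z) ≤ (a ∧ w)
  ∧-monotonicʳ a z≤w = ⊑⇒≤
    (MeetSemilatticeProperties.∧-monotonic ⊑.meetSemilattice ⊑.refl (≤⇒⊑ z≤w))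

  -- (2) Residuation: z ≤ a ⇒ (a ∧ y) exactly when a ∧ z ≤ y.  In a
  -- semi-Heyting algebra  a ⇒ (a ∧ y)  plays the role of the relative
  -- pseudocomplement of a with respect to y.

  ⇒-residual-intro : ∀ {a z y} → (a ∧ z) ≤ y → z ≤ (a ⇒ (a ∧ y))
  ⇒-residual-intro {a} {z} {y} a∧z≤y = begin
    z ∧ (a ⇒ (a ∧ y))              ≈⟨ SH2 z a (a ∧ y) ⟩
    z ∧ ((z ∧ a) ⇒ (z ∧ (a ∧ y)))  ≈⟨ ∧-congˡ (⇒-cong refl z∧a∧y≈z∧a) ⟩
    z ∧ ((z ∧ a) ⇒ (z ∧ a))        ≈⟨ ∧-congˡ (SH3 (z ∧ a)) ⟩
    z ∧ ⊤                          ≈⟨ ⊤-greatest z ⟩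
    z                              ∎
    where
    z∧a∧y≈z∧a : (z ∧ (a ∧ y)) ≈ (z ∧ a)
    z∧a∧y≈z∧a = begin
      z ∧ (a ∧ y)  ≈⟨ sym (∧-assoc z a y) ⟩
      (z ∧ a) ∧ y  ≈⟨ ∧-congʳ (∧-comm z a) ⟩
      (a ∧ z) ∧ y  ≈⟨ a∧z≤y ⟩
      a ∧ z        ≈⟨ ∧-comm a z ⟩
      z ∧ a        ∎

  ⇒-residual-elim : ∀ {a z y} → z ≤ (a ⇒ (a ∧ y)) → (a ∧ z) ≤ y
  ⇒-residual-elim {a} {z} {y} z≤a⇒a∧y = ≤-trans (∧-monotonicʳ a z≤a⇒a∧y)
    (≤-trans (≤-reflexive (SH1 a (a ∧ y)))
    (≤-trans (x∧y≤y a (a ∧ y)) (x∧y≤y a y)))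

  -- Meet distributes over join.  (The converse inequality holds in any
  -- lattice, so the underlying lattice of a semi-Heyting algebra is
  -- distributive.)  Both joinands lie below  a ⇒ (a ∧ r)  for
  -- r = (a ∧ b) ∨ (a ∧ d), hence so does their join.
  ∧-distribˡ-∨-≤ : ∀ a b d → (a ∧ (b ∨ d)) ≤ ((a ∧ b) ∨ (a ∧ d))
  ∧-distribˡ-∨-≤ a b d = ⇒-residual-elim (∨-least
    (⇒-residual-intro (x≤x∨y (a ∧ b) (a ∧ d)))
    (⇒-residual-intro (y≤x∨y (a ∧ b) (a ∧ d))))

  x∧x*≈⊥ : ∀ x → (x ∧ (x *)) ≈ ⊥
  x∧x*≈⊥ x = begin
    x ∧ (x ⇒ ⊥)  ≈⟨ SH1 x ⊥ ⟩
    x ∧ ⊥        ≈⟨ ∧-comm x ⊥ ⟩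
    ⊥ ∧ x        ≈⟨ ⊥-least x ⟩
    ⊥            ∎

  ′-antitone : ∀ {x y} → x ≤ y → (y ′) ≤ (x ′)
  ′-antitone {x} {y} x≤y = ≤-trans (y≤x∨y (x ′) (y ′)) (≤-reflexive (begin
    (x ′) ∨ (y ′)  ≈⟨ sym (∧-′ x y) ⟩
    (x ∧ y) ′      ≈⟨ ′-cong x≤y ⟩
    x ′            ∎))

  x′∨x*′≈⊤ : ∀ x → ((x ′) ∨ ((x *) ′)) ≈ ⊤
  x′∨x*′≈⊤ x = begin
    (x ′) ∨ ((x *) ′)  ≈⟨ sym (∧-′ x (x *)) ⟩
    (x ∧ (x *)) ′      ≈⟨ ′-cong (x∧x*≈⊥ x) ⟩
    ⊥ ′                ≈⟨ ⊥′ ⟩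
    ⊤                  ∎

  -- The key inequality x′* ≤ x*′, by distributing x′* over x′ ∨ x*′ ≈ 1.
  x′*≤x*′ : ∀ x → ((x ′) *) ≤ ((x *) ′)
  x′*≤x*′ x = ≤-trans a≤a∧⊤
    (≤-trans (∧-distribˡ-∨-≤ a (x ′) ((x *) ′))
             (∨-least a∧x′≤x*′ (x∧y≤y a ((x *) ′))))
    where
    a : Carrier
    a = (x ′) *

    a≤a∧⊤ : a ≤ (a ∧ ((x ′) ∨ ((x *) ′)))
    a≤a∧⊤ = ∧-greatest (≤-reflexive refl)
      (≤-trans (⊤-greatest a) (≤-reflexive (sym (x′∨x*′≈⊤ x))))

    a∧x′≤x*′ : (a ∧ (x ′)) ≤ ((x *) ′)
    a∧x′≤x*′ = ≤-trans
      (≤-reflexive (trans (∧-comm a (x ′)) (x∧x*≈⊥ (x ′))))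
      (⊥-least ((x *) ′))

lemma4p6 : ∀ {c ℓ} (L : DmsStoneSH c ℓ) → let open DmsStoneSH L in
    ∀ x → (((x *) ′) ′) ≤ (((x ′) *) ′)
lemma4p6 L x = ′-antitone (x′*≤x*′ x)
  where open DmsStoneSHProperties L
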